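{- For any graph $G$ of order $n$ and size $m$, \[K(S(G))\le 2\left[\binom{n+m}{2}-\binom{n}{2}\right]+K(G),\] with equality if and only if $G$ is $2$-connected.
   Context: Graphs are finite and simple. For a graph $H$ and distinct vertices $u,v$, $\kappa_H(u,v)$ is the maximum number of internally disjoint $u$--$v$ paths; the total connectivity $K(H)$ is the sum of $\kappa_H(u,v)$ over all unordered pairs of distinct vertices. The subdivision $S(G)$ has vertex set $V(G)\cup E(G)$, with $u\in V(G)$ adjacent to $e\in E(G)$ exactly when $u$ is an endvertex of $e$ (i.e., each edge is replaced by a path of length $2$). -}

module Defs where

open import Data.Bool using (Bool; true; false; T; _∨_)
open import Data.Nat using (ℕ; _<_; _≤_)
open import Data.Nat.Properties using (_<?_)
open import Data.Nat.ListAction using (sum)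
open import Data.Fin using (Fin; toℕ; splitAt; _≟_)
open import Data.Sum using (_⊎_; inj₁; inj₂)
open import Data.Product using (_×_; _,_; ∃; ∃-syntax; proj₁; proj₂)
open import Data.List using (List; []; _∷_; length; map; filter; cartesianProduct; lookup; allFin)
open import Data.List.Membership.Propositional using (_∈_; _∉_)
open import Data.List.Relation.Unary.All using (All)
open import Data.List.Relation.Unary.AllPairs using (AllPairs)
import Data.List.Relation.Unary.Unique.Propositional as U
open import Relation.Nullary using (¬_; Dec; yes; no)
open import Relation.Nullary.Decidable using (⌊_⌋)
open import Relation.Binary.PropositionalEquality using (_≡_; _≢_; refl)

record Graph : Set where
  field
    n      : ℕ
    adj    : Fin n → Fin n → Bool
    sym    : ∀ i j → adj i j ≡ adj j i
    irrefl : ∀ i → adj i i ≡ false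
open Graph public

-- Unordered pairs {i,j} of distinct elements of Fin N, represented as (i , j) with i < j.
pairs : (N : ℕ) → List (Fin N × Fin N)
pairs N = filter (λ p → toℕ (proj₁ p) <? toℕ (proj₂ p)) (cartesianProduct (allFin N) (allFin N))

edges : (G : Graph) → List (Fin (n G) × Fin (n G))
edges G = filter (λ p → T? (adj G (proj₁ p) (proj₂ p))) (pairs (n G))
  where
  T? : (b : Bool) → Dec (T b)
  T? true  = yes _
  T? false = no (λ ())

size : Graph → ℕ
size G = length (edges G)

pairSum : (N : ℕ) → (Fin N → Fin N → ℕ) → ℕ
pairSum N f = sum (map (λ p → f (proj₁ p) (proj₂ p)) (pairs N))

-- Subdivision S(G): vertex set Fin (n + m); the first n vertices are V(G) (via splitAt),
-- vertex n + k is the k-th edge of G; a vertex a is adjacent to an edge e iff a is an endpoint of e.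
module _ (G : Graph) where
  private
    isEnd : Fin (n G) → Fin (size G) → Bool
    isEnd a k = ⌊ a ≟ proj₁ (lookup (edges G) k) ⌋ ∨ ⌊ a ≟ proj₂ (lookup (edges G) k) ⌋

    h : Fin (n G) ⊎ Fin (size G) → Fin (n G) ⊎ Fin (size G) → Bool
    h (inj₁ a) (inj₁ b) = false
    h (inj₁ a) (inj₂ k) = isEnd a k
    h (inj₂ k) (inj₁ a) = isEnd a k
    h (inj₂ k) (inj₂ l) = false

    h-sym : ∀ x y → h x y ≡ h y x
    h-sym (inj₁ a) (inj₁ b) = refl
    h-sym (inj₁ a) (inj₂ k) = refl
    h-sym (inj₂ k) (inj₁ a) = refl
    h-sym (inj₂ k) (inj₂ l) = refl

    h-irr : ∀ x → h x x ≡ false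
    h-irr (inj₁ a) = refl
    h-irr (inj₂ k) = refl

  S : Graph
  S = record
    { n      = n G Data.Nat.+ size G
    ; adj    = λ x y → h (splitAt (n G) x) (splitAt (n G) y)
    ; sym    = λ x y → h-sym (splitAt (n G) x) (splitAt (n G) y)
    ; irrefl = λ x → h-irr (splitAt (n G) x)
    }

data Walk (G : Graph) : Fin (n G) → Fin (n G) → List (Fin (n G)) → Set where
  here : ∀ u → Walk G u u (u ∷ [])
  step : ∀ {u w v p} → T (adj G u w) → Walk G w v p → Walk G u v (u ∷ p)

IsPath : (G : Graph) → Fin (n G) → Fin (n G) → List (Fin (n G)) → Set
IsPath G u v p = Walk G u v p × U.Unique p

IDFamily : (G : Graph) → Fin (n G) → Fin (n G) → List (List (Fin (n G))) → Set
IDFamily G u v ps =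
  All (IsPath G u v) ps × U.Unique ps ×
  AllPairs (λ p q → ∀ x → x ∈ p → x ∈ q → x ≡ u ⊎ x ≡ v) ps

IsKappa : (G : Graph) → Fin (n G) → Fin (n G) → ℕ → Set
IsKappa G u v k =
  (∃[ ps ] (IDFamily G u v ps × length ps ≡ k)) ×
  (∀ ps → IDFamily G u v ps → length ps ≤ k)

IsConnectivity : (G : Graph) → (Fin (n G) → Fin (n G) → ℕ) → Set
IsConnectivity G κ = ∀ u v → u ≢ v → IsKappa G u v (κ u v)

TotalConn : (G : Graph) → (Fin (n G) → Fin (n G) → ℕ) → ℕ
TotalConn G κ = pairSum (n G) κ

Connected : Graph → Set
Connected G = ∀ u w → ∃[ p ] Walk G u w p

TwoConnected : Graph → Set
TwoConnected G =
  3 ≤ n G × Connected G ×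
  (∀ x u w → u ≢ x → w ≢ x → ∃[ p ] (Walk G u w p × x ∉ p))

module Submission where

-- A subdivision vertex has degree 2, so it is joined to any other vertex of S(G) by at most two
-- internally disjoint paths. Between two original vertices a, b one has κ_S(G)(a,b) = κ_G(a,b):
-- paths of G lift to paths of S(G) and paths of S(G) between original vertices project back to
-- paths of G, both constructions preserving distinctness and internal disjointness. Summing, the
-- pairs not both original contribute at most 2(nm + C(m,2)) = 2[C(n+m,2) − C(n,2)], with equality
-- iff each of them is joined by two internally disjoint paths. If G is 2-connected then so is S(G),
-- and Whitney's theorem provides these paths. Conversely, fix an edge e. For every vertex a and
-- every x ≠ a one of the two a–e paths avoids x, and its projection reaches an end of e in G − x,
-- so G − x is connected; and an a–e path other than the edge itself leaves a along a second edge,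
-- whose other end is a third vertex of G.

open import Defs
open import Data.Nat using (ℕ; _+_; _*_; _∸_; _≤_)
open import Data.Nat.Combinatorics using (_C_)
open import Data.Fin using (Fin)
open import Data.Product using (_×_)
open import Relation.Binary.PropositionalEquality using (_≡_)

open import Data.Bool using (T)
open import Data.Empty using (⊥; ⊥-elim)
open import Data.Fin using (_≟_) renaming (zero to fzero; suc to fsuc)
open import Data.Fin.Properties using (injective⇒≤)
open import Data.List using (List; []; _∷_; _++_; [_]; length; map; reverse; lookup)
open import Data.List.Membership.Propositional using (_∈_; _∉_)
open import Data.List.Membership.Propositional.Properties using (∈-++⁻; ∈-lookup)
open import Data.List.Properties using (unfold-reverse; reverse-injective; length-map; ≡-dec; ∷-injectiveʳ)
open import Data.List.Relation.Binary.Subset.Propositional using (_⊆_)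
open import Data.List.Relation.Unary.All as All using (All; []; _∷_)
open import Data.List.Relation.Unary.All.Properties using (¬Any⇒All¬; All¬⇒¬Any)
import Data.List.Relation.Unary.All.Properties as Allₚ
open import Data.List.Relation.Unary.AllPairs as AllPairs using (AllPairs; []; _∷_)
open import Data.List.Relation.Unary.Any as Any using (Any; here; there)
open import Data.List.Relation.Unary.Any.Properties using (reverse⁻)
open import Data.List.Relation.Unary.Unique.Propositional using (Unique)
open import Data.List.Relation.Unary.Unique.Propositional.Properties using (Unique[x∷xs]⇒x∉xs)
import Data.List.Relation.Unary.Unique.Propositional.Properties as Uniqueₚ
open import Data.Nat using (zero; suc; s≤s; z≤n; _<_)
open import Data.Product using (∃-syntax; _,_; proj₁; proj₂)
open import Data.Sum using (_⊎_; inj₁; inj₂; [_,_]′; swap)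
open import Function using (_∘_; id)
open import Relation.Nullary using (¬_; Dec; yes; no)
open import Relation.Nullary.Decidable using (_⊎-dec_)
open import Relation.Binary.PropositionalEquality
  using (_≢_; refl; trans; cong; cong₂; subst; subst₂; module ≡-Reasoning) renaming (sym to ≡-sym)

module _ {A : Set} where

  Unique-∷ : ∀ {x : A} {xs} → x ∉ xs → Unique xs → Unique (x ∷ xs)
  Unique-∷ {xs = xs} x∉xs xs! = ¬Any⇒All¬ xs x∉xs ∷ xs!

  Unique-reverse : ∀ {xs : List A} → Unique xs → Unique (reverse xs)
  Unique-reverse {xs} = Unique-resp-↭ (↭-sym (↭-reverse xs))
    where
    open import Relation.Binary.PropositionalEquality using (setoid)
    open import Data.List.Relation.Binary.Permutation.Setoid (setoid A) using (↭-sym)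
    open import Data.List.Relation.Binary.Permutation.Setoid.Properties (setoid A) using (Unique-resp-↭; ↭-reverse)

  Unique-map⁺ : ∀ {B : Set} {P : A → Set} {R : A → A → Set} (f : A → B) →
                (∀ {x y} → P x → P y → R x y → f x ≢ f y) →
                ∀ {xs} → All P xs → AllPairs R xs → Unique (map f xs)
  Unique-map⁺ f separates [] [] = []
  Unique-map⁺ f separates (px ∷ pxs) (rxs ∷ rxss) =
    Allₚ.map⁺ (All.zipWith (λ (py , rxy) → separates px py rxy) (pxs , rxs)) ∷ Unique-map⁺ f separates pxs rxss

  length≤2 : ∀ {a b : A} {xs} → Unique xs → All (λ x → x ≡ a ⊎ x ≡ b) xs → length xs ≤ 2
  length≤2 {xs = []} _ _ = z≤n
  length≤2 {xs = _ ∷ []} _ _ = s≤s z≤n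
  length≤2 {xs = _ ∷ _ ∷ []} _ _ = s≤s (s≤s z≤n)
  length≤2 {xs = _ ∷ _ ∷ _ ∷ _} ((x≢y ∷ x≢z ∷ _) ∷ (y≢z ∷ _) ∷ _) (x∈ ∷ y∈ ∷ z∈ ∷ _) =
    ⊥-elim (pigeonhole x∈ y∈ z∈ x≢y x≢z y≢z)
    where
    pigeonhole : ∀ {a b x y z : A} → x ≡ a ⊎ x ≡ b → y ≡ a ⊎ y ≡ b → z ≡ a ⊎ z ≡ b →
                 x ≢ y → x ≢ z → y ≢ z → ⊥
    pigeonhole (inj₁ refl) (inj₁ refl) _ x≢y _ _ = x≢y refl
    pigeonhole (inj₂ refl) (inj₂ refl) _ x≢y _ _ = x≢y refl
    pigeonhole (inj₁ refl) (inj₂ refl) (inj₁ refl) _ x≢z _ = x≢z refl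
    pigeonhole (inj₁ refl) (inj₂ refl) (inj₂ refl) _ _ y≢z = y≢z refl
    pigeonhole (inj₂ refl) (inj₁ refl) (inj₁ refl) _ _ y≢z = y≢z refl
    pigeonhole (inj₂ refl) (inj₁ refl) (inj₂ refl) _ x≢z _ = x≢z refl

  lookup-injective : ∀ {xs : List A} → Unique xs → ∀ {i j} → lookup xs i ≡ lookup xs j → i ≡ j
  lookup-injective {_ ∷ _} _ {fzero} {fzero} _ = refl
  lookup-injective {_ ∷ _} (x∉ ∷ _) {fzero} {fsuc j} eq =
    ⊥-elim (All¬⇒¬Any x∉ (subst (_∈ _) (≡-sym eq) (∈-lookup j)))
  lookup-injective {_ ∷ _} (x∉ ∷ _) {fsuc i} {fzero} eq =
    ⊥-elim (All¬⇒¬Any x∉ (subst (_∈ _) eq (∈-lookup i)))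
  lookup-injective {_ ∷ _} (_ ∷ xs!) {fsuc i} {fsuc j} eq = cong fsuc (lookup-injective xs! eq)

  data Consecutive : List A → A → A → Set where
    here : ∀ {x y r} → Consecutive (x ∷ y ∷ r) x y
    there : ∀ {z r x y} → Consecutive r x y → Consecutive (z ∷ r) x y

  consecutive-∈ : ∀ {p x y} → Consecutive p x y → x ∈ p × y ∈ p
  consecutive-∈ here = here refl , there (here refl)
  consecutive-∈ (there xy) = let (x∈ , y∈) = consecutive-∈ xy in there x∈ , there y∈

  second : A → List A → A
  second _ (_ ∷ z ∷ _) = z
  second x _ = x

  InternallyDisjoint : A → A → List A → List A → Set
  InternallyDisjoint u v p q = ∀ z → z ∈ p → z ∈ q → z ≡ u ⊎ z ≡ v

third : ∀ {N} → 3 ≤ N → (u v : Fin N) → ∃[ c ] (c ≢ u × c ≢ v)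
third {suc zero} (s≤s ()) _ _
third {suc (suc zero)} (s≤s (s≤s ())) _ _
third {suc (suc (suc _))} _ u v with fzero ≟ u | fzero ≟ v | fsuc fzero ≟ u | fsuc fzero ≟ v
... | no 0≢u | no 0≢v | _ | _ = fzero , 0≢u , 0≢v
... | _ | _ | no 1≢u | no 1≢v = fsuc fzero , 1≢u , 1≢v
... | yes refl | _ | _ | yes refl = fsuc (fsuc fzero) , (λ ()) , (λ ())
... | _ | yes refl | yes refl | _ = fsuc (fsuc fzero) , (λ ()) , (λ ())
... | yes refl | _ | yes () | _
... | _ | yes refl | _ | yes ()

three-distinct⇒3≤ : ∀ {N} {a b c : Fin N} → a ≢ b → a ≢ c → b ≢ c → 3 ≤ N
three-distinct⇒3≤ {a = a} {b} {c} a≢b a≢c b≢c = injective⇒≤ {f = f} injective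
  where
  f : Fin 3 → Fin _
  f fzero = a
  f (fsuc fzero) = b
  f (fsuc (fsuc fzero)) = c
  injective : ∀ {i j} → f i ≡ f j → i ≡ j
  injective {fzero} {fzero} _ = refl
  injective {fzero} {fsuc fzero} e = ⊥-elim (a≢b e)
  injective {fzero} {fsuc (fsuc fzero)} e = ⊥-elim (a≢c e)
  injective {fsuc fzero} {fzero} e = ⊥-elim (a≢b (≡-sym e))
  injective {fsuc fzero} {fsuc fzero} _ = refl
  injective {fsuc fzero} {fsuc (fsuc fzero)} e = ⊥-elim (b≢c e)
  injective {fsuc (fsuc fzero)} {fzero} e = ⊥-elim (a≢c (≡-sym e))
  injective {fsuc (fsuc fzero)} {fsuc fzero} e = ⊥-elim (b≢c (≡-sym e))
  injective {fsuc (fsuc fzero)} {fsuc (fsuc fzero)} _ = refl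

-- Walks and paths

module Walks (H : Graph) where

  private
    V : Set
    V = Fin (n H)

  open import Data.List.Membership.DecPropositional (_≟_ {n H}) using (_∈?_)

  adj⇒≢ : ∀ {u w} → T (adj H u w) → u ≢ w
  adj⇒≢ {u} t refl = subst T (irrefl H u) t

  adj-sym : ∀ {u w} → T (adj H u w) → T (adj H w u)
  adj-sym {u} {w} = subst T (Graph.sym H u w)

  head∈ : ∀ {u v p} → Walk H u v p → u ∈ p
  head∈ (here _) = here refl
  head∈ (step _ _) = here refl

  last∈ : ∀ {u v p} → Walk H u v p → v ∈ p
  last∈ (here _) = here refl
  last∈ (step _ w) = there (last∈ w)

  walk-head : ∀ {u v p} → Walk H u v p → ∃[ r ] (p ≡ u ∷ r)
  walk-head (here _) = _ , refl
  walk-head (step _ _) = _ , refl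

  first-step : ∀ {u v p} → Walk H u v p → u ≢ v → ∃[ w ] ∃[ r ] (p ≡ u ∷ r × T (adj H u w) × Walk H w v r)
  first-step (here _) u≢v = ⊥-elim (u≢v refl)
  first-step (step t w) _ = _ , _ , refl , t , w

  walk-snoc : ∀ {u v w p} → Walk H u v p → T (adj H v w) → Walk H u w (p ++ [ w ])
  walk-snoc (here _) t = step t (here _)
  walk-snoc (step t′ p) t = step t′ (walk-snoc p t)

  walk-reverse : ∀ {u v p} → Walk H u v p → Walk H v u (reverse p)
  walk-reverse (here u) = here u
  walk-reverse {u} (step {p = p} t w) =
    subst (Walk H _ u) (≡-sym (unfold-reverse u p)) (walk-snoc (walk-reverse w) (adj-sym t))

  path-reverse : ∀ {u v p} → IsPath H u v p → IsPath H v u (reverse p)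
  path-reverse (w , p!) = walk-reverse w , Unique-reverse p!

  consecutive-adjacent : ∀ {u v p x y} → Walk H u v p → Consecutive p x y → T (adj H x y)
  consecutive-adjacent (step t (here _)) here = t
  consecutive-adjacent (step t (step _ _)) here = t
  consecutive-adjacent (step _ w) (there xy) = consecutive-adjacent w xy

  consecutive-head : ∀ {u w v p} → Walk H w v p → Consecutive (u ∷ p) u w
  consecutive-head (here _) = here
  consecutive-head (step _ _) = here

  consecutive-ends⇒direct : ∀ {u v p x y} → IsPath H u v p → Consecutive p x y → x ≢ y →
                            x ≡ u ⊎ x ≡ v → y ≡ u ⊎ y ≡ v → p ≡ u ∷ v ∷ []
  consecutive-ends⇒direct _ _ x≢y (inj₁ refl) (inj₁ refl) = ⊥-elim (x≢y refl)
  consecutive-ends⇒direct _ _ x≢y (inj₂ refl) (inj₂ refl) = ⊥-elim (x≢y refl)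
  consecutive-ends⇒direct (step _ (here _) , _) here _ (inj₁ refl) (inj₂ refl) = refl
  consecutive-ends⇒direct (step _ (step _ w) , _ ∷ v∉ ∷ _) here _ (inj₁ refl) (inj₂ refl) =
    ⊥-elim (All¬⇒¬Any v∉ (last∈ w))
  consecutive-ends⇒direct (step _ _ , _) here x≢y (inj₂ refl) (inj₁ refl) = ⊥-elim (x≢y refl)
  consecutive-ends⇒direct (step _ _ , u∉ ∷ _) (there xy) _ (inj₁ refl) (inj₂ refl) =
    ⊥-elim (All¬⇒¬Any u∉ (proj₁ (consecutive-∈ xy)))
  consecutive-ends⇒direct (step _ _ , u∉ ∷ _) (there xy) _ (inj₂ refl) (inj₁ refl) =
    ⊥-elim (All¬⇒¬Any u∉ (proj₂ (consecutive-∈ xy)))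

  -- A walk from u up to x, with x itself left out of the list.
  data Prefix : V → V → List V → Set where
    [] : ∀ {x} → Prefix x x []
    _∷_ : ∀ {u w x pre} → T (adj H u w) → Prefix w x pre → Prefix u x (u ∷ pre)

  _▸_ : ∀ {u x v pre q} → Prefix u x pre → Walk H x v q → Walk H u v (pre ++ q)
  [] ▸ w = w
  (t ∷ pre) ▸ w = step t (pre ▸ w)

  prefix-head : ∀ {u x pre} → Prefix u x pre → u ≡ x ⊎ u ∈ pre
  prefix-head [] = inj₁ refl
  prefix-head (_ ∷ _) = inj₂ (here refl)

  WalkAvoiding : V → V → V → Set
  WalkAvoiding x u w = ∃[ p ] (Walk H u w p × x ∉ p)

  Avoidance : Set
  Avoidance = ∀ x u w → u ≢ x → w ≢ x → WalkAvoiding x u w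

  avoiding-reverse : ∀ {x u v} → WalkAvoiding x u v → WalkAvoiding x v u
  avoiding-reverse (p , w , x∉) = reverse p , walk-reverse w , x∉ ∘ reverse⁻

  avoiding-step : ∀ {x u w v} → T (adj H u w) → u ≢ x → WalkAvoiding x w v → WalkAvoiding x u v
  avoiding-step t u≢x (p , w , x∉) = _ , step t w , λ { (here refl) → u≢x refl ; (there m) → x∉ m }

  avoiding-++ : ∀ {x u v w} → WalkAvoiding x u v → WalkAvoiding x v w → WalkAvoiding x u w
  avoiding-++ {x} {v = v} {w} (_ , wp , x∉p) q = go wp x∉p
    where
    go : ∀ {u p} → Walk H u v p → x ∉ p → WalkAvoiding x u w
    go (here _) _ = q
    go (step t wp) x∉ = avoiding-step t (λ { refl → x∉ (here refl) }) (go wp (x∉ ∘ there))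

  avoidance⇒connected : 3 ≤ n H → Avoidance → Connected H
  avoidance⇒connected 3≤n avoid u w with third 3≤n u w
  ... | c , c≢u , c≢w with avoid c u w (c≢u ∘ ≡-sym) (c≢w ∘ ≡-sym)
  ...   | p , walk , _ = p , walk

  suffix-from : ∀ {w v x P} → IsPath H w v P → x ∈ P →
                ∃[ S ] (IsPath H x v S × S ⊆ P × (x ≢ w → w ∉ S))
  suffix-from π@(here _ , _) (here refl) = _ , π , id , λ x≢w → ⊥-elim (x≢w refl)
  suffix-from π@(step _ _ , _) (here refl) = _ , π , id , λ x≢w → ⊥-elim (x≢w refl)
  suffix-from (step _ w , w∉ ∷ P!) (there x∈) with suffix-from (w , P!) x∈
  ... | S , σ , S⊆ , _ = S , σ , there ∘ S⊆ , λ _ → All¬⇒¬Any w∉ ∘ S⊆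

  walk⇒path : ∀ {u v p} → Walk H u v p → ∃[ q ] (IsPath H u v q × q ⊆ p)
  walk⇒path (here u) = [ u ] , (here u , [] ∷ []) , id
  walk⇒path {u} (step t w) with walk⇒path w
  ... | q , (wq , q!) , q⊆ with u ∈? q
  ...   | no u∉q =
    u ∷ q , (step t wq , Unique-∷ u∉q q!) , λ { (here refl) → here refl ; (there m) → there (q⊆ m) }
  ...   | yes u∈q with suffix-from (wq , q!) u∈q
  ...     | S , σ , S⊆q , _ = S , σ , there ∘ q⊆ ∘ S⊆q

  avoiding-path : ∀ {x u w} → WalkAvoiding x u w → ∃[ q ] (IsPath H u w q × x ∉ q)
  avoiding-path (_ , w , x∉) with walk⇒path w
  ... | q , π , q⊆ = q , π , x∉ ∘ q⊆

  record FirstHit (Z : V → Set) (u : V) (R : List V) : Set where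
    field
      hit : V
      pre : List V
      prefix : Prefix u hit pre
      hit-Z : Z hit
      hit∈R : hit ∈ R
      pre⊆R : pre ⊆ R
      pre-avoids-Z : ∀ {y} → y ∈ pre → ¬ Z y
      pre-unique : Unique pre

  first-hit : ∀ {Z : V → Set} → (∀ y → Dec (Z y)) → ∀ {u v R} → IsPath H u v R → Any Z R → FirstHit Z u R
  first-hit Z? {u} _ _ with Z? u
  first-hit Z? (w , _) _ | yes zu = record
    { hit = _ ; pre = [] ; prefix = [] ; hit-Z = zu ; hit∈R = head∈ w
    ; pre⊆R = λ () ; pre-avoids-Z = λ () ; pre-unique = [] }
  first-hit Z? (here _ , _) (here zu) | no ¬zu = ⊥-elim (¬zu zu)
  first-hit Z? (step _ _ , _) (here zu) | no ¬zu = ⊥-elim (¬zu zu)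
  first-hit Z? (step t w , u∉ ∷ R!) (there z∈) | no ¬zu = record
    { hit = hit ; pre = _ ∷ pre ; prefix = t ∷ prefix ; hit-Z = hit-Z ; hit∈R = there hit∈R
    ; pre⊆R = λ { (here refl) → here refl ; (there m) → there (pre⊆R m) }
    ; pre-avoids-Z = λ { (here refl) → ¬zu ; (there m) → pre-avoids-Z m }
    ; pre-unique = Unique-∷ (All¬⇒¬Any u∉ ∘ pre⊆R) pre-unique }
    where open FirstHit (first-hit Z? (w , R!) z∈)

  second-adjacent : ∀ {x y p} → Walk H x y p → x ≢ y → T (adj H x (second x p))
  second-adjacent (here _) x≢y = ⊥-elim (x≢y refl)
  second-adjacent (step t (here _)) _ = t
  second-adjacent (step t (step _ _)) _ = t

  second-∈ : ∀ {x y p} → Walk H x y p → x ≢ y → second x p ∈ p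
  second-∈ (here _) x≢y = ⊥-elim (x≢y refl)
  second-∈ (step _ (here _)) _ = there (here refl)
  second-∈ (step _ (step _ _)) _ = there (here refl)

  second≡end⇒direct : ∀ {x y p} → IsPath H x y p → x ≢ y → second x p ≡ y → p ≡ x ∷ y ∷ []
  second≡end⇒direct (here _ , _) x≢y _ = ⊥-elim (x≢y refl)
  second≡end⇒direct (step _ (here _) , _) _ refl = refl
  second≡end⇒direct (step _ (step _ w) , _ ∷ z∉ ∷ _) _ refl = ⊥-elim (All¬⇒¬Any z∉ (last∈ w))

  second-injective : ∀ {x y p q} → IsPath H x y p → IsPath H x y q → x ≢ y →
                     p ≢ q → InternallyDisjoint x y p q → second x p ≢ second x q
  second-injective π ρ x≢y p≢q dj eq
    with dj _ (second-∈ (proj₁ π) x≢y) (subst (_∈ _) (≡-sym eq) (second-∈ (proj₁ ρ) x≢y))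
  ... | inj₁ s≡x = adj⇒≢ (second-adjacent (proj₁ π) x≢y) (≡-sym s≡x)
  ... | inj₂ s≡y = p≢q (trans (second≡end⇒direct π x≢y s≡y)
                              (≡-sym (second≡end⇒direct ρ x≢y (trans (≡-sym eq) s≡y))))

-- Internally disjoint paths

record TwoPaths (H : Graph) (u v : Fin (n H)) : Set where
  field
    {p q} : List (Fin (n H))
    p-path : IsPath H u v p
    q-path : IsPath H u v q
    distinct : p ≢ q
    disjoint : InternallyDisjoint u v p q

TwoPaths-swap : ∀ {H u v} → TwoPaths H u v → TwoPaths H u v
TwoPaths-swap P = record
  { p-path = q-path ; q-path = p-path ; distinct = distinct ∘ ≡-sym
  ; disjoint = λ z z∈q z∈p → disjoint z z∈p z∈q }
  where open TwoPaths P

TwoPaths-avoiding : ∀ {H u v} → TwoPaths H u v → ∀ x → x ≢ u → x ≢ v → ∃[ r ] (IsPath H u v r × x ∉ r)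
TwoPaths-avoiding {H} {u} {v} P x x≢u x≢v = avoid (x ∈? p)
  where
  open TwoPaths P
  open import Data.List.Membership.DecPropositional (_≟_ {n H}) using (_∈?_)
  avoid : Dec (x ∈ p) → ∃[ r ] (IsPath H u v r × x ∉ r)
  avoid (no x∉p) = _ , p-path , x∉p
  avoid (yes x∈p) = _ , q-path , λ x∈q → [ x≢u , x≢v ]′ (disjoint x x∈p x∈q)

TwoPaths⇒2≤κ : ∀ {H u v k} → TwoPaths H u v → IsKappa H u v k → 2 ≤ k
TwoPaths⇒2≤κ P (_ , maximal) =
  maximal _ ((p-path ∷ q-path ∷ []) , ((distinct ∷ []) ∷ [] ∷ []) , ((disjoint ∷ []) ∷ [] ∷ []))
  where open TwoPaths P

κ≡2⇒TwoPaths : ∀ {H u v} → IsKappa H u v 2 → TwoPaths H u v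
κ≡2⇒TwoPaths ((_ ∷ _ ∷ [] , (π ∷ ρ ∷ [] , (p≢q ∷ []) ∷ _ , (dj ∷ []) ∷ _) , refl) , _) = record
  { p-path = π ; q-path = ρ ; distinct = p≢q ; disjoint = dj }

record PathTransfer (H H′ : Graph) (u v : Fin (n H)) (u′ v′ : Fin (n H′)) : Set where
  field
    image : ∀ {p} → IsPath H u v p → List (Fin (n H′))
    image-path : ∀ {p} (π : IsPath H u v p) → IsPath H′ u′ v′ (image π)
    image-distinct : ∀ {p q} (π : IsPath H u v p) (ρ : IsPath H u v q) →
                     p ≢ q → InternallyDisjoint u v p q → image π ≢ image ρ
    image-disjoint : ∀ {p q} (π : IsPath H u v p) (ρ : IsPath H u v q) →
                     p ≢ q → InternallyDisjoint u v p q → InternallyDisjoint u′ v′ (image π) (image ρ)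

  private
    images : ∀ {ps} → All (IsPath H u v) ps → List (List (Fin (n H′)))
    images = All.reduce image

    images-separated : ∀ {p ps} (π : IsPath H u v p) (πs : All (IsPath H u v) ps) →
                       All (p ≢_) ps → All (InternallyDisjoint u v p) ps →
                       All (image π ≢_) (images πs) × All (InternallyDisjoint u′ v′ (image π)) (images πs)
    images-separated π [] [] [] = [] , []
    images-separated π (ρ ∷ πs) (p≢q ∷ ≢s) (dj ∷ djs) =
      let (≢s′ , djs′) = images-separated π πs ≢s djs
      in image-distinct π ρ p≢q dj ∷ ≢s′ , image-disjoint π ρ p≢q dj ∷ djs′

    images-family : ∀ {ps} (fam : IDFamily H u v ps) →
                    IDFamily H′ u′ v′ (images (proj₁ fam)) × length (images (proj₁ fam)) ≡ length ps
    images-family {[]} ([] , [] , []) = ([] , [] , []) , refl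
    images-family {p ∷ ps} (π ∷ πs , ≢s ∷ uniq , djs ∷ disj) =
      let ((σs , uniq′ , disj′) , len) = images-family (πs , uniq , disj)
          (≢s′ , djs′) = images-separated π πs ≢s djs
      in (image-path π ∷ σs , ≢s′ ∷ uniq′ , djs′ ∷ disj′) , cong suc len

  transfer-family : ∀ {ps} → IDFamily H u v ps → ∃[ qs ] (IDFamily H′ u′ v′ qs × length qs ≡ length ps)
  transfer-family fam = images (proj₁ fam) , images-family fam

  κ-mono : ∀ {k k′} → IsKappa H u v k → IsKappa H′ u′ v′ k′ → k ≤ k′
  κ-mono ((_ , fam , refl) , _) (_ , maximal) =
    let (qs , fam′ , len) = transfer-family fam in subst (_≤ _) len (maximal qs fam′)

reverse-transfer : ∀ {H u v} → PathTransfer H H u v v u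
reverse-transfer {H} = record
  { image = λ {p} _ → reverse p
  ; image-path = Walks.path-reverse H
  ; image-distinct = λ _ _ p≢q _ → p≢q ∘ reverse-injective
  ; image-disjoint = λ _ _ _ dj z z∈p z∈q → swap (dj z (reverse⁻ z∈p) (reverse⁻ z∈q))
  }

IsKappa-sym : ∀ {H u v k} → IsKappa H u v k → IsKappa H v u k
IsKappa-sym ((_ , fam , refl) , maximal) =
  PathTransfer.transfer-family reverse-transfer fam ,
  λ qs fam′ → let (_ , fam″ , len) = PathTransfer.transfer-family reverse-transfer fam′
              in subst (_≤ _) len (maximal _ fam″)

-- Distinct internally disjoint paths leave x through distinct neighbours.
κ≤2-at-degree-2 : ∀ {H x y a b k} → x ≢ y → (∀ z → T (adj H x z) → z ≡ a ⊎ z ≡ b) →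
                  IsKappa H x y k → k ≤ 2
κ≤2-at-degree-2 {H} {x} {y} {a} {b} x≢y neighbours ((ps , (πs , uniq , disj) , refl) , _) =
  subst (_≤ 2) (length-map (second x) ps) (length≤2 seconds-unique seconds-neighbours)
  where
  open Walks H using (second-injective; second-adjacent)
  seconds-unique : Unique (map (second x) ps)
  seconds-unique = Unique-map⁺ (second x) (λ π ρ (p≢q , dj) → second-injective π ρ x≢y p≢q dj)
                               πs (AllPairs.zipWith id (uniq , disj))
  seconds-neighbours : All (λ z → z ≡ a ⊎ z ≡ b) (map (second x) ps)
  seconds-neighbours = Allₚ.map⁺ (All.map (λ π → neighbours _ (second-adjacent (proj₁ π) x≢y)) πs)

-- Whitney's theorem

module Whitney (H : Graph) (2-connected : TwoConnected H) where
  open Walks H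
  open import Data.List.Membership.DecPropositional (_≟_ {n H}) using (_∈?_)

  private
    avoid : Avoidance
    avoid = proj₂ (proj₂ 2-connected)

  -- Besides the edge uv itself: leave u towards a third vertex without passing through v, and
  -- return from the first step w to v without passing through u.
  edge-on-two-paths : ∀ {u v} → T (adj H u v) → TwoPaths H u v
  edge-on-two-paths {u} {v} t with third (proj₁ 2-connected) u v
  ... | c , c≢u , c≢v with avoiding-path (avoid v u c (adj⇒≢ t) c≢v)
  ...   | _ , (here _ , _) , _ = ⊥-elim (c≢u refl)
  ...   | _ , (step {w = w} t′ rest , _) , v∉R
          with avoiding-path (avoid u w v (adj⇒≢ t′ ∘ ≡-sym) (adj⇒≢ t ∘ ≡-sym))
  ...     | _ , (wQ , Q!) , u∉Q = record
    { p-path = step t (here v) , Unique-∷ (λ { (here u≡v) → adj⇒≢ t u≡v }) ([] ∷ [])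
    ; q-path = step t′ wQ , Unique-∷ u∉Q Q!
    ; distinct = λ eq → w≢v (w∈[v] (subst (w ∈_) (≡-sym (∷-injectiveʳ eq)) (head∈ wQ)))
    ; disjoint = λ { z (here refl) _ → inj₁ refl ; z (there (here refl)) _ → inj₂ refl }
    }
    where
    w≢v : w ≢ v
    w≢v refl = v∉R (there (head∈ rest))
    w∈[v] : w ∈ v ∷ [] → w ≡ v
    w∈[v] (here w≡v) = w≡v

  -- R runs from u to v avoiding w and first meets p ∪ q at a vertex x of p; then R up to x
  -- followed by p from x, and the edge uw followed by q, are internally disjoint.
  reroute : ∀ {u w v R} {Z : Fin (n H) → Set} → T (adj H u w) → u ≢ v → (P : TwoPaths H w v) →
            (∀ {y} → y ∈ TwoPaths.p P → Z y) → (∀ {y} → y ∈ TwoPaths.q P → Z y) → w ∉ R →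
            (h : FirstHit Z u R) → FirstHit.hit h ∈ TwoPaths.p P → TwoPaths H u v
  reroute {u} {w} {v} t u≢v P p⊆Z q⊆Z w∉R h x∈p with suffix-from (TwoPaths.p-path P) x∈p
  ... | S , σ , S⊆p , w∉S = record
    { p-path = prefix ▸ proj₁ σ ,
               Uniqueₚ.++⁺ pre-unique (proj₂ σ) (λ (y∈pre , y∈S) → pre-avoids-Z y∈pre (p⊆Z (S⊆p y∈S)))
    ; q-path = step t (proj₁ q-path) , Unique-∷ u∉q (proj₂ q-path)
    ; distinct = λ eq → w∉pre++S (subst (w ∈_) (≡-sym eq) (there (head∈ (proj₁ q-path))))
    ; disjoint = disjoint′
    }
    where
    open TwoPaths P
    open FirstHit h
    x≢w : hit ≢ w
    x≢w refl = w∉R hit∈R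
    w∉pre++S : w ∉ pre ++ S
    w∉pre++S m = [ w∉R ∘ pre⊆R , w∉S x≢w ]′ (∈-++⁻ pre m)
    u∉q : u ∉ q
    u∉q u∈q with prefix-head prefix
    ... | inj₂ u∈pre = pre-avoids-Z u∈pre (q⊆Z u∈q)
    ... | inj₁ refl with disjoint u x∈p u∈q
    ...   | inj₁ u≡w = adj⇒≢ t u≡w
    ...   | inj₂ u≡v = u≢v u≡v
    disjoint′ : InternallyDisjoint u v (pre ++ S) (u ∷ q)
    disjoint′ z _ (here refl) = inj₁ refl
    disjoint′ z z∈pre++S (there z∈q) with ∈-++⁻ pre z∈pre++S
    ... | inj₁ z∈pre = ⊥-elim (pre-avoids-Z z∈pre (q⊆Z z∈q))
    ... | inj₂ z∈S with disjoint z (S⊆p z∈S) z∈q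
    ...   | inj₁ refl = ⊥-elim (w∉S x≢w z∈S)
    ...   | inj₂ z≡v = inj₂ z≡v

  extend : ∀ {u w v} → T (adj H u w) → u ≢ v → w ≢ v → TwoPaths H w v → TwoPaths H u v
  extend {u} {w} {v} t u≢v w≢v P with avoiding-path (avoid w u v (adj⇒≢ t) (w≢v ∘ ≡-sym))
  ... | R , ρ , w∉R = reroute-at (first-hit on-p-or-q? ρ v-on-p)
    where
    open TwoPaths P
    on-p-or-q? : ∀ y → Dec (y ∈ p ⊎ y ∈ q)
    on-p-or-q? y = (y ∈? p) ⊎-dec (y ∈? q)
    v-on-p : Any (λ y → y ∈ p ⊎ y ∈ q) R
    v-on-p = Any.map (λ { refl → inj₁ (last∈ (proj₁ p-path)) }) (last∈ (proj₁ ρ))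
    reroute-at : FirstHit (λ y → y ∈ p ⊎ y ∈ q) u R → TwoPaths H u v
    reroute-at h with FirstHit.hit-Z h
    ... | inj₁ x∈p = reroute t u≢v P inj₁ inj₂ w∉R h x∈p
    ... | inj₂ x∈q = reroute t u≢v (TwoPaths-swap P) inj₂ inj₁ w∉R h x∈q

  two-paths : ∀ {u v} → u ≢ v → TwoPaths H u v
  two-paths {u} {v} = along (proj₂ (proj₁ (proj₂ 2-connected) u v))
    where
    along : ∀ {u p} → Walk H u v p → u ≢ v → TwoPaths H u v
    along (here _) u≢v = ⊥-elim (u≢v refl)
    along (step {w = w} t rest) u≢v with w ≟ v
    ... | yes refl = edge-on-two-paths t
    ... | no w≢v = extend t u≢v w≢v (along rest w≢v)

-- Sums over pairs of distinct vertices

module PairSums where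
  open import Data.Fin using (toℕ; splitAt)
  open import Data.List using (filter; cartesianProduct; allFin; tabulate)
  open import Data.List.Properties
    using (filter-++; filter-accept; filter-reject; filter-all; map-++; map-∘; map-tabulate; tabulate-cong)
  open import Data.Nat.ListAction using (sum)
  open import Data.Nat.ListAction.Properties using (sum-++)
  open import Data.Nat.Properties
    using (_<?_; ≤-pred; +-assoc; *-distribʳ-+; <-irrefl; ≤-antisym; ≤-reflexive;
           +-cancelˡ-≡; +-cancelʳ-≤; +-monoʳ-≤; +-mono-≤)
  open import Data.List.Membership.Propositional.Properties
    using (∈-filter⁺; ∈-filter⁻; ∈-cartesianProduct⁺; ∈-allFin)
  open import Data.Nat.Combinatorics using (nCk+nC[k+1]≡[n+1]C[k+1]; nC1≡n)
  open import Data.Nat.Tactic.RingSolver using (solve-∀)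
  import Data.Product as Product
  import Data.Sum as Sum
  open ≡-Reasoning

  ordered? : ∀ {N} (p : Fin N × Fin N) → Dec (toℕ (proj₁ p) < toℕ (proj₂ p))
  ordered? p = toℕ (proj₁ p) <? toℕ (proj₂ p)

  ∈-pairs⇒< : ∀ {N} {i j : Fin N} → (i , j) ∈ pairs N → toℕ i < toℕ j
  ∈-pairs⇒< = proj₂ ∘ ∈-filter⁻ ordered? {xs = cartesianProduct (allFin _) (allFin _)}

  <⇒∈-pairs : ∀ {N} {i j : Fin N} → toℕ i < toℕ j → (i , j) ∈ pairs N
  <⇒∈-pairs {i = i} {j} = ∈-filter⁺ ordered? (∈-cartesianProduct⁺ (∈-allFin i) (∈-allFin j))

  ∈-pairs⇒≢ : ∀ {N} {i j : Fin N} → (i , j) ∈ pairs N → i ≢ j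
  ∈-pairs⇒≢ m refl = <-irrefl refl (∈-pairs⇒< m)

  shift : ∀ {N} → Fin N × Fin N → Fin (suc N) × Fin (suc N)
  shift = Product.map fsuc fsuc

  row-shift : ∀ {N} (x : Fin N) ys →
              filter ordered? (map (fsuc x ,_) (map fsuc ys)) ≡ map shift (filter ordered? (map (x ,_) ys))
  row-shift x [] = refl
  row-shift x (y ∷ ys) with ordered? (x , y)
  ... | yes x<y = trans (filter-accept ordered? (s≤s x<y))
                        (trans (cong (_ ∷_) (row-shift x ys)) (cong (map shift) (≡-sym (filter-accept ordered? x<y))))
  ... | no x≮y = trans (filter-reject ordered? (x≮y ∘ ≤-pred))
                       (trans (row-shift x ys) (cong (map shift) (≡-sym (filter-reject ordered? x≮y))))

  rows-shift : ∀ {N} (xs ys : List (Fin N)) →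
               filter ordered? (cartesianProduct (map fsuc xs) (fzero ∷ map fsuc ys)) ≡
               map shift (filter ordered? (cartesianProduct xs ys))
  rows-shift [] ys = refl
  rows-shift (x ∷ xs) ys = begin
    filter ordered? (map (fsuc x ,_) (map fsuc ys) ++ cartesianProduct (map fsuc xs) (fzero ∷ map fsuc ys))
      ≡⟨ filter-++ ordered? (map (fsuc x ,_) (map fsuc ys)) _ ⟩
    filter ordered? (map (fsuc x ,_) (map fsuc ys)) ++ filter ordered? (cartesianProduct (map fsuc xs) (fzero ∷ map fsuc ys))
      ≡⟨ cong₂ _++_ (row-shift x ys) (rows-shift xs ys) ⟩
    map shift (filter ordered? (map (x ,_) ys)) ++ map shift (filter ordered? (cartesianProduct xs ys))
      ≡⟨ map-++ shift (filter ordered? (map (x ,_) ys)) _ ⟨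
    map shift (filter ordered? (map (x ,_) ys) ++ filter ordered? (cartesianProduct xs ys))
      ≡⟨ cong (map shift) (filter-++ ordered? (map (x ,_) ys) _) ⟨
    map shift (filter ordered? (cartesianProduct (x ∷ xs) ys)) ∎

  pairs-suc : ∀ N → pairs (suc N) ≡ map (fzero ,_) (tabulate fsuc) ++ map shift (pairs N)
  pairs-suc N = begin
    filter ordered? (map (fzero ,_) (tabulate fsuc) ++ cartesianProduct (tabulate fsuc) (fzero ∷ tabulate fsuc))
      ≡⟨ filter-++ ordered? (map (fzero ,_) (tabulate fsuc)) _ ⟩
    filter ordered? (map (fzero ,_) (tabulate fsuc)) ++ filter ordered? (cartesianProduct (tabulate fsuc) (fzero ∷ tabulate fsuc))
      ≡⟨ cong₂ _++_ (filter-all ordered? (Allₚ.map⁺ (Allₚ.tabulate⁺ (λ _ → s≤s z≤n))))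
                    (cong (λ T → filter ordered? (cartesianProduct T (fzero ∷ T))) (≡-sym (map-tabulate id fsuc))) ⟩
    map (fzero ,_) (tabulate fsuc) ++ filter ordered? (cartesianProduct (map fsuc (allFin N)) (fzero ∷ map fsuc (allFin N)))
      ≡⟨ cong (map (fzero ,_) (tabulate fsuc) ++_) (rows-shift (allFin N) (allFin N)) ⟩
    map (fzero ,_) (tabulate fsuc) ++ map shift (pairs N) ∎

  pairSum-suc : ∀ N f → pairSum (suc N) f ≡ sum (tabulate (f fzero ∘ fsuc)) + pairSum N (λ i j → f (fsuc i) (fsuc j))
  pairSum-suc N f = begin
    sum (map f′ (pairs (suc N)))
      ≡⟨ cong (sum ∘ map f′) (pairs-suc N) ⟩
    sum (map f′ (map (fzero ,_) (tabulate fsuc) ++ map shift (pairs N)))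
      ≡⟨ cong sum (map-++ f′ (map (fzero ,_) (tabulate fsuc)) _) ⟩
    sum (map f′ (map (fzero ,_) (tabulate fsuc)) ++ map f′ (map shift (pairs N)))
      ≡⟨ sum-++ (map f′ (map (fzero ,_) (tabulate fsuc))) _ ⟩
    sum (map f′ (map (fzero ,_) (tabulate fsuc))) + sum (map f′ (map shift (pairs N)))
      ≡⟨ cong₂ _+_ (cong sum (trans (≡-sym (map-∘ (tabulate fsuc))) (map-tabulate fsuc (f fzero))))
                   (cong sum (≡-sym (map-∘ (pairs N)))) ⟩
    sum (tabulate (f fzero ∘ fsuc)) + pairSum N (λ i j → f (fsuc i) (fsuc j)) ∎
    where
    f′ : Fin (suc N) × Fin (suc N) → ℕ
    f′ (i , j) = f i j

  +-≤-≡⇒≡ : ∀ {a b c d} → a ≤ b → c ≤ d → a + c ≡ b + d → a ≡ b × c ≡ d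
  +-≤-≡⇒≡ {a} {b} {c} {d} a≤b c≤d eq = a≡b , +-cancelˡ-≡ b c d (subst (λ z → z + c ≡ b + d) a≡b eq)
    where
    a≡b : a ≡ b
    a≡b = ≤-antisym a≤b (+-cancelʳ-≤ c b a (subst (b + c ≤_) (≡-sym eq) (+-monoʳ-≤ b c≤d)))

  module _ {A : Set} where
    sum-map-mono : ∀ xs {f g : A → ℕ} → (∀ {x} → x ∈ xs → f x ≤ g x) → sum (map f xs) ≤ sum (map g xs)
    sum-map-mono [] _ = z≤n
    sum-map-mono (x ∷ xs) f≤g = +-mono-≤ (f≤g (here refl)) (sum-map-mono xs (f≤g ∘ there))

    sum-map-≡⇒≡ : ∀ xs {f g : A → ℕ} → (∀ {x} → x ∈ xs → f x ≤ g x) →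
                  sum (map f xs) ≡ sum (map g xs) → ∀ {x} → x ∈ xs → f x ≡ g x
    sum-map-≡⇒≡ (y ∷ xs) f≤g eq m
      with +-≤-≡⇒≡ (f≤g (here refl)) (sum-map-mono xs (f≤g ∘ there)) eq
    sum-map-≡⇒≡ (y ∷ xs) f≤g eq (here refl) | fy≡gy , _ = fy≡gy
    sum-map-≡⇒≡ (y ∷ xs) f≤g eq (there m) | _ , rest = sum-map-≡⇒≡ xs (f≤g ∘ there) rest m

  pairSum-mono : ∀ N {f g : Fin N → Fin N → ℕ} → (∀ i j → i ≢ j → f i j ≤ g i j) →
                 pairSum N f ≤ pairSum N g
  pairSum-mono N f≤g = sum-map-mono (pairs N) (λ {(i , j)} m → f≤g i j (∈-pairs⇒≢ m))

  pairSum-≡⇒≡ : ∀ N {f g : Fin N → Fin N → ℕ} → (∀ i j → i ≢ j → f i j ≤ g i j) →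
                pairSum N f ≡ pairSum N g → ∀ {i j} → (i , j) ∈ pairs N → f i j ≡ g i j
  pairSum-≡⇒≡ N f≤g eq m = sum-map-≡⇒≡ (pairs N) (λ {(i , j)} m → f≤g i j (∈-pairs⇒≢ m)) eq m

  pairSum-cong : ∀ N {f g : Fin N → Fin N → ℕ} → (∀ i j → i ≢ j → f i j ≡ g i j) →
                 pairSum N f ≡ pairSum N g
  pairSum-cong N f≡g = ≤-antisym (pairSum-mono N (λ i j i≢j → ≤-reflexive (f≡g i j i≢j)))
                                 (pairSum-mono N (λ i j i≢j → ≤-reflexive (≡-sym (f≡g i j i≢j))))

  sum-tabulate-const : ∀ m c → sum (tabulate {n = m} (λ _ → c)) ≡ m * c
  sum-tabulate-const zero c = refl
  sum-tabulate-const (suc m) c = cong (c +_) (sum-tabulate-const m c)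

  sum-tabulate-splitAt : ∀ N M (f : Fin N → ℕ) (g : Fin M → ℕ) →
                         sum (tabulate ([ f , g ]′ ∘ splitAt N)) ≡ sum (tabulate f) + sum (tabulate g)
  sum-tabulate-splitAt zero M f g = refl
  sum-tabulate-splitAt (suc N) M f g =
    trans (cong (f fzero +_) (trans (cong sum (tabulate-cong split-suc)) (sum-tabulate-splitAt N M (f ∘ fsuc) g)))
          (≡-sym (+-assoc (f fzero) _ _))
    where
    split-suc : ∀ i → [ f , g ]′ (Sum.map₁ fsuc (splitAt N i)) ≡ [ f ∘ fsuc , g ]′ (splitAt N i)
    split-suc i with splitAt N i
    ... | inj₁ _ = refl
    ... | inj₂ _ = refl

  C2-suc : ∀ n → suc n C 2 ≡ n + n C 2
  C2-suc n = trans (≡-sym (nCk+nC[k+1]≡[n+1]C[k+1] n 1)) (cong (_+ n C 2) (nC1≡n n))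

  C2-+ : ∀ n m → (n + m) C 2 ≡ n C 2 + (n * m + m C 2)
  C2-+ zero m = refl
  C2-+ (suc n) m = begin
    suc (n + m) C 2               ≡⟨ C2-suc (n + m) ⟩
    n + m + (n + m) C 2           ≡⟨ cong (n + m +_) (C2-+ n m) ⟩
    n + m + (n C 2 + (n * m + m C 2)) ≡⟨ rearrange n m (n C 2) (m C 2) ⟩
    n + n C 2 + (suc n * m + m C 2)   ≡⟨ cong (_+ (suc n * m + m C 2)) (C2-suc n) ⟨
    suc n C 2 + (suc n * m + m C 2) ∎
    where
    rearrange : ∀ n m a b → n + m + (a + (n * m + b)) ≡ n + a + (suc n * m + b)
    rearrange = solve-∀

  pairSum-const : ∀ m c → pairSum m (λ _ _ → c) ≡ (m C 2) * c
  pairSum-const zero c = refl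
  pairSum-const (suc m) c = begin
    pairSum (suc m) (λ _ _ → c)          ≡⟨ pairSum-suc m (λ _ _ → c) ⟩
    sum (tabulate {n = m} (λ _ → c)) + pairSum m (λ _ _ → c)
                                         ≡⟨ cong₂ _+_ (sum-tabulate-const m c) (pairSum-const m c) ⟩
    m * c + (m C 2) * c                  ≡⟨ *-distribʳ-+ c m (m C 2) ⟨
    (m + m C 2) * c                      ≡⟨ cong (_* c) (C2-suc m) ⟨
    (suc m C 2) * c ∎

  bound : ∀ {N M} → (Fin N → Fin N → ℕ) → Fin N ⊎ Fin M → Fin N ⊎ Fin M → ℕ
  bound κ (inj₁ a) (inj₁ b) = κ a b
  bound κ (inj₁ _) (inj₂ _) = 2
  bound κ (inj₂ _) _ = 2

  κ-bound : ∀ N M → (Fin N → Fin N → ℕ) → Fin (N + M) → Fin (N + M) → ℕ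
  κ-bound N M κ x y = bound {N} {M} κ (splitAt N x) (splitAt N y)

  pairSum-κ-bound : ∀ N M κ → pairSum (N + M) (κ-bound N M κ) ≡ 2 * (N * M + M C 2) + pairSum N κ
  pairSum-κ-bound zero M κ = trans (pairSum-const M 2) (doubled (M C 2))
    where
    doubled : ∀ b → b * 2 ≡ 2 * b + 0
    doubled = solve-∀
  pairSum-κ-bound (suc N) M κ = begin
    pairSum (suc N + M) (κ-bound (suc N) M κ)
      ≡⟨ pairSum-suc (N + M) (κ-bound (suc N) M κ) ⟩
    sum (tabulate (κ-bound (suc N) M κ fzero ∘ fsuc)) + pairSum (N + M) (λ i j → κ-bound (suc N) M κ (fsuc i) (fsuc j))
      ≡⟨ cong₂ _+_ (trans (cong sum (tabulate-cong first-row)) (sum-tabulate-splitAt N M (κ fzero ∘ fsuc) (λ _ → 2)))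
                   (pairSum-cong (N + M) (λ i j _ → shifted (splitAt N i) (splitAt N j))) ⟩
    sum (tabulate (κ fzero ∘ fsuc)) + sum (tabulate {n = M} (λ _ → 2)) + pairSum (N + M) (κ-bound N M κ′)
      ≡⟨ cong₂ _+_ (cong (sum (tabulate (κ fzero ∘ fsuc)) +_) (sum-tabulate-const M 2)) (pairSum-κ-bound N M κ′) ⟩
    sum (tabulate (κ fzero ∘ fsuc)) + M * 2 + (2 * (N * M + M C 2) + pairSum N κ′)
      ≡⟨ rearrange (sum (tabulate (κ fzero ∘ fsuc))) N M (M C 2) (pairSum N κ′) ⟩
    2 * (suc N * M + M C 2) + (sum (tabulate (κ fzero ∘ fsuc)) + pairSum N κ′)
      ≡⟨ cong (2 * (suc N * M + M C 2) +_) (pairSum-suc N κ) ⟨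
    2 * (suc N * M + M C 2) + pairSum (suc N) κ ∎
    where
    κ′ : Fin N → Fin N → ℕ
    κ′ i j = κ (fsuc i) (fsuc j)
    first-row : ∀ j → bound κ (inj₁ fzero) (Sum.map₁ fsuc (splitAt N j)) ≡
                      [ κ fzero ∘ fsuc , (λ _ → 2) ]′ (splitAt N j)
    first-row j with splitAt N j
    ... | inj₁ _ = refl
    ... | inj₂ _ = refl
    shifted : ∀ s t → bound κ (Sum.map₁ fsuc s) (Sum.map₁ fsuc t) ≡ bound {N} {M} κ′ s t
    shifted (inj₁ _) (inj₁ _) = refl
    shifted (inj₁ _) (inj₂ _) = refl
    shifted (inj₂ _) _ = refl
    rearrange : ∀ s n m b p → s + m * 2 + (2 * (n * m + b) + p) ≡ 2 * (suc n * m + b) + (s + p)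
    rearrange = solve-∀

-- The subdivision S(G)

module Subdivision (G : Graph) where
  open import Data.Bool.Properties using (T-∨)
  open import Data.Fin using (toℕ; _↑ˡ_; _↑ʳ_; splitAt)
  open import Data.Fin.Properties
    using (splitAt-↑ˡ; splitAt-↑ʳ; splitAt⁻¹-↑ˡ; splitAt⁻¹-↑ʳ; ↑ˡ-injective; ↑ʳ-injective; toℕ-injective)
  open import Data.List.Membership.Propositional.Properties using (∈-filter⁺; ∈-filter⁻)
  open import Data.List.Relation.Unary.Any.Properties using (lookup-index)
  open import Data.Nat.Properties using (<-irrefl; <-asym; <-cmp; ≤-antisym; ≤-trans; m≤m+n)
  open import Function.Bundles using (Equivalence)
  open import Relation.Binary.Definitions using (tri<; tri≈; tri>)
  open import Relation.Nullary.Decidable using (toWitness; fromWitness)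
  open PairSums using (∈-pairs⇒<; <⇒∈-pairs)

  N : ℕ
  N = n G

  M : ℕ
  M = size G

  SG : Graph
  SG = S G

  module InG = Walks G
  module InS = Walks SG

  ι : Fin N → Fin (N + M)
  ι a = a ↑ˡ M

  ε : Fin M → Fin (N + M)
  ε k = N ↑ʳ k

  data Kind : Fin (N + M) → Set where
    vertex : ∀ a → Kind (ι a)
    edge : ∀ k → Kind (ε k)

  kind : ∀ x → Kind x
  kind x with splitAt N x in eq
  ... | inj₁ a = subst Kind (splitAt⁻¹-↑ˡ eq) (vertex a)
  ... | inj₂ k = subst Kind (splitAt⁻¹-↑ʳ eq) (edge k)

  ι-injective : ∀ {a b} → ι a ≡ ι b → a ≡ b
  ι-injective = ↑ˡ-injective M _ _

  ε-injective : ∀ {k l} → ε k ≡ ε l → k ≡ l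
  ε-injective = ↑ʳ-injective N _ _

  ι≢ε : ∀ {a k} → ι a ≢ ε k
  ι≢ε {a} {k} eq with trans (≡-sym (splitAt-↑ˡ N a M)) (trans (cong (splitAt N) eq) (splitAt-↑ʳ N M k))
  ... | ()

  ends : Fin M → Fin N × Fin N
  ends k = lookup (edges G) k

  Incident : Fin N → Fin M → Set
  Incident a k = a ≡ proj₁ (ends k) ⊎ a ≡ proj₂ (ends k)

  incident⇒adj : ∀ {a k} → Incident a k → T (adj SG (ι a) (ε k))
  incident⇒adj {a} {k} a-k rewrite splitAt-↑ˡ N a M | splitAt-↑ʳ N M k =
    Equivalence.from T-∨ ([ inj₁ ∘ fromWitness {a? = a ≟ _} , inj₂ ∘ fromWitness {a? = a ≟ _} ]′ a-k)

  adj⇒incident : ∀ {a k} → T (adj SG (ι a) (ε k)) → Incident a k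
  adj⇒incident {a} {k} t rewrite splitAt-↑ˡ N a M | splitAt-↑ʳ N M k =
    [ inj₁ ∘ toWitness {a? = a ≟ _} , inj₂ ∘ toWitness {a? = a ≟ _} ]′ (Equivalence.to T-∨ t)

  adj-ιι : ∀ {a b} → ¬ T (adj SG (ι a) (ι b))
  adj-ιι {a} {b} rewrite splitAt-↑ˡ N a M | splitAt-↑ˡ N b M = λ ()

  adj-εε : ∀ {k l} → ¬ T (adj SG (ε k) (ε l))
  adj-εε {k} {l} rewrite splitAt-↑ʳ N M k | splitAt-↑ʳ N M l = λ ()

  neighbour-of-vertex : ∀ {a y} → T (adj SG (ι a) y) → ∃[ k ] (y ≡ ε k × Incident a k)
  neighbour-of-vertex {y = y} t with kind y
  ... | vertex _ = ⊥-elim (adj-ιι t)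
  ... | edge k = k , refl , adj⇒incident t

  neighbour-of-edge : ∀ {k y} → T (adj SG (ε k) y) → ∃[ a ] (y ≡ ι a × Incident a k)
  neighbour-of-edge {y = y} t with kind y
  ... | vertex a = a , refl , adj⇒incident (InS.adj-sym t)
  ... | edge _ = ⊥-elim (adj-εε t)

  edge-neighbours : ∀ k z → T (adj SG (ε k) z) → z ≡ ι (proj₁ (ends k)) ⊎ z ≡ ι (proj₂ (ends k))
  edge-neighbours k z t with neighbour-of-edge t
  ... | _ , refl , inj₁ refl = inj₁ refl
  ... | _ , refl , inj₂ refl = inj₂ refl

  edges-unique : Unique (edges G)
  edges-unique =
    Uniqueₚ.filter⁺ _ (Uniqueₚ.filter⁺ _ (Uniqueₚ.cartesianProduct⁺ (Uniqueₚ.allFin⁺ N) (Uniqueₚ.allFin⁺ N)))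

  ends-adjacent : ∀ k → T (adj G (proj₁ (ends k)) (proj₂ (ends k)))
  ends-adjacent k = proj₂ (∈-filter⁻ _ {xs = pairs N} (∈-lookup k))

  ends-< : ∀ k → toℕ (proj₁ (ends k)) < toℕ (proj₂ (ends k))
  ends-< k = ∈-pairs⇒< (proj₁ (∈-filter⁻ _ {xs = pairs N} (∈-lookup k)))

  ends-distinct : ∀ k → proj₁ (ends k) ≢ proj₂ (ends k)
  ends-distinct k eq = <-irrefl (cong toℕ eq) (ends-< k)

  ordered-edge : ∀ {x y} → T (adj G x y) → toℕ x < toℕ y → ∃[ k ] (ends k ≡ (x , y))
  ordered-edge t x<y = let m = ∈-filter⁺ _ (<⇒∈-pairs x<y) t in Any.index m , ≡-sym (lookup-index m)

  edge-between : ∀ {a b} → T (adj G a b) → ∃[ k ] (Incident a k × Incident b k)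
  edge-between {a} {b} t with <-cmp (toℕ a) (toℕ b)
  ... | tri< a<b _ _ =
    let (k , e) = ordered-edge t a<b in k , inj₁ (cong proj₁ (≡-sym e)) , inj₂ (cong proj₂ (≡-sym e))
  ... | tri≈ _ a≡b _ = ⊥-elim (InG.adj⇒≢ t (toℕ-injective a≡b))
  ... | tri> _ _ b<a =
    let (k , e) = ordered-edge (InG.adj-sym t) b<a in k , inj₂ (cong proj₂ (≡-sym e)) , inj₁ (cong proj₁ (≡-sym e))

  incident-adjacent : ∀ {a b k} → a ≢ b → Incident a k → Incident b k → T (adj G a b)
  incident-adjacent {k = k} a≢b (inj₁ refl) (inj₂ refl) = ends-adjacent k
  incident-adjacent {k = k} a≢b (inj₂ refl) (inj₁ refl) = InG.adj-sym (ends-adjacent k)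
  incident-adjacent a≢b (inj₁ refl) (inj₁ refl) = ⊥-elim (a≢b refl)
  incident-adjacent a≢b (inj₂ refl) (inj₂ refl) = ⊥-elim (a≢b refl)

  incident-other : ∀ {a b c k} → a ≢ b → Incident a k → Incident b k → Incident c k → c ≡ a ⊎ c ≡ b
  incident-other a≢b (inj₁ refl) (inj₂ refl) c-k = c-k
  incident-other a≢b (inj₂ refl) (inj₁ refl) c-k = swap c-k
  incident-other a≢b (inj₁ refl) (inj₁ refl) _ = ⊥-elim (a≢b refl)
  incident-other a≢b (inj₂ refl) (inj₂ refl) _ = ⊥-elim (a≢b refl)

  other-end : ∀ {a k} → Incident a k → ∃[ b ] (Incident b k × a ≢ b)
  other-end {k = k} (inj₁ refl) = _ , inj₂ refl , ends-distinct k
  other-end {k = k} (inj₂ refl) = _ , inj₁ refl , ends-distinct k ∘ ≡-sym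

  endpoint-avoiding : ∀ k c → ∃[ a ] (Incident a k × a ≢ c)
  endpoint-avoiding k c with proj₁ (ends k) ≟ c
  ... | yes refl = _ , inj₂ refl , ends-distinct k ∘ ≡-sym
  ... | no e₁≢c = _ , inj₁ refl , e₁≢c

  -- Edges are stored as pairs (x , y) with x < y, so two distinct common endpoints fix the pair.
  edge-unique : ∀ {a b k l} → a ≢ b → Incident a k → Incident b k → Incident a l → Incident b l → k ≡ l
  edge-unique {k = k} {l} a≢b a-k b-k a-l b-l = lookup-injective edges-unique (same-ends a-k b-k a-l b-l)
    where
    ordered : ∀ {x y} → x ≡ proj₁ (ends l) → y ≡ proj₂ (ends l) → toℕ x < toℕ y
    ordered refl refl = ends-< l
    same-ends : Incident _ k → Incident _ k → Incident _ l → Incident _ l → ends k ≡ ends l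
    same-ends (inj₁ refl) (inj₂ refl) (inj₁ e₁) (inj₂ e₂) = cong₂ _,_ e₁ e₂
    same-ends (inj₂ refl) (inj₁ refl) (inj₂ e₁) (inj₁ e₂) = cong₂ _,_ e₂ e₁
    same-ends (inj₁ refl) (inj₂ refl) (inj₂ e₁) (inj₁ e₂) = ⊥-elim (<-asym (ends-< k) (ordered e₂ e₁))
    same-ends (inj₂ refl) (inj₁ refl) (inj₁ e₁) (inj₂ e₂) = ⊥-elim (<-asym (ends-< k) (ordered e₁ e₂))
    same-ends _ _ (inj₁ e₁) (inj₁ e₂) = ⊥-elim (a≢b (trans e₁ (≡-sym e₂)))
    same-ends _ _ (inj₂ e₁) (inj₂ e₂) = ⊥-elim (a≢b (trans e₁ (≡-sym e₂)))
    same-ends (inj₁ refl) (inj₁ refl) _ _ = ⊥-elim (a≢b refl)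
    same-ends (inj₂ refl) (inj₂ refl) _ _ = ⊥-elim (a≢b refl)

  lift : ∀ {u v p} → Walk G u v p → List (Fin (N + M))
  lift (here u) = [ ι u ]
  lift (step {u} t w) = ι u ∷ ε (proj₁ (edge-between t)) ∷ lift w

  lift-walk : ∀ {u v p} (w : Walk G u v p) → Walk SG (ι u) (ι v) (lift w)
  lift-walk (here u) = here (ι u)
  lift-walk (step t w) with edge-between t
  ... | _ , u-k , w-k = step (incident⇒adj u-k) (step (InS.adj-sym (incident⇒adj w-k)) (lift-walk w))

  ι-∈-lift : ∀ {u v p a} (w : Walk G u v p) → ι a ∈ lift w → a ∈ p
  ι-∈-lift (here _) (here eq) = here (ι-injective eq)
  ι-∈-lift (step _ _) (here eq) = here (ι-injective eq)
  ι-∈-lift (step _ _) (there (here eq)) = ⊥-elim (ι≢ε eq)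
  ι-∈-lift (step _ w) (there (there m)) = there (ι-∈-lift w m)

  ε-∈-lift : ∀ {u v p k} (w : Walk G u v p) → ε k ∈ lift w →
             ∃[ x ] ∃[ y ] (Consecutive p x y × Incident x k × Incident y k)
  ε-∈-lift (here _) (here eq) = ⊥-elim (ι≢ε (≡-sym eq))
  ε-∈-lift (step _ _) (here eq) = ⊥-elim (ι≢ε (≡-sym eq))
  ε-∈-lift (step t w) (there (here eq)) with ε-injective eq
  ... | refl = _ , _ , InG.consecutive-head w , proj₂ (edge-between t)
  ε-∈-lift (step _ w) (there (there m)) =
    let (x , y , xy , incident) = ε-∈-lift w m in x , y , there xy , incident

  endpoint-∈ : ∀ {u v p x y z k} → Walk G u v p → Consecutive p x y →
               Incident x k → Incident y k → Incident z k → z ∈ p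
  endpoint-∈ w xy x-k y-k z-k with incident-other (InG.adj⇒≢ (InG.consecutive-adjacent w xy)) x-k y-k z-k
  ... | inj₁ refl = proj₁ (consecutive-∈ xy)
  ... | inj₂ refl = proj₂ (consecutive-∈ xy)

  ε∉lift : ∀ {u v p c k} (w : Walk G u v p) → Incident c k → c ∉ p → ε k ∉ lift w
  ε∉lift w c-k c∉p m with ε-∈-lift w m
  ... | _ , _ , xy , x-k , y-k = c∉p (endpoint-∈ w xy x-k y-k c-k)

  lift-unique : ∀ {u v p} (w : Walk G u v p) → Unique p → Unique (lift w)
  lift-unique (here _) _ = [] ∷ []
  lift-unique (step t w) (u∉ ∷ p!) =
    Unique-∷ (λ { (here eq) → ι≢ε eq ; (there m) → All¬⇒¬Any u∉ (ι-∈-lift w m) })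
             (Unique-∷ (ε∉lift w (proj₁ (proj₂ (edge-between t))) (All¬⇒¬Any u∉)) (lift-unique w p!))

  vertices : List (Fin (N + M)) → List (Fin N)
  vertices [] = []
  vertices (x ∷ xs) with splitAt N x
  ... | inj₁ a = a ∷ vertices xs
  ... | inj₂ _ = vertices xs

  vertices-ι : ∀ a xs → vertices (ι a ∷ xs) ≡ a ∷ vertices xs
  vertices-ι a xs rewrite splitAt-↑ˡ N a M = refl

  vertices-ε : ∀ k xs → vertices (ε k ∷ xs) ≡ vertices xs
  vertices-ε k xs rewrite splitAt-↑ʳ N M k = refl

  vertices-ιε : ∀ a k xs → vertices (ι a ∷ ε k ∷ xs) ≡ a ∷ vertices xs
  vertices-ιε a k xs = trans (vertices-ι a _) (cong (a ∷_) (vertices-ε k xs))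

  vertices-ιει : ∀ a k c xs → vertices (ι a ∷ ε k ∷ ι c ∷ xs) ≡ a ∷ c ∷ vertices xs
  vertices-ιει a k c xs = trans (vertices-ιε a k _) (cong (a ∷_) (vertices-ι c xs))

  ∈-vertices⁻ : ∀ {a} xs → a ∈ vertices xs → ι a ∈ xs
  ∈-vertices⁻ (x ∷ xs) m with kind x
  ... | vertex b with subst (_ ∈_) (vertices-ι b xs) m
  ...   | here refl = here refl
  ...   | there m′ = there (∈-vertices⁻ xs m′)
  ∈-vertices⁻ (x ∷ xs) m | edge k = there (∈-vertices⁻ xs (subst (_ ∈_) (vertices-ε k xs) m))

  vertices-unique : ∀ {xs} → Unique xs → Unique (vertices xs)
  vertices-unique [] = []
  vertices-unique {x ∷ xs} (x∉ ∷ xs!) with kind x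
  ... | vertex a = subst Unique (≡-sym (vertices-ι a xs))
                     (Unique-∷ (All¬⇒¬Any x∉ ∘ ∈-vertices⁻ xs) (vertices-unique xs!))
  ... | edge k = subst Unique (≡-sym (vertices-ε k xs)) (vertices-unique xs!)

  vertices-lift : ∀ {u v p} (w : Walk G u v p) → vertices (lift w) ≡ p
  vertices-lift (here u) = vertices-ι u []
  vertices-lift (step {u} t w) = trans (vertices-ιε u _ _) (cong (u ∷_) (vertices-lift w))

  -- A subdivision vertex shared by two lifted paths forces both to be the single edge uv.
  lift-disjoint : ∀ {u v p q} (π : IsPath G u v p) (ρ : IsPath G u v q) → p ≢ q →
                  InternallyDisjoint u v p q → InternallyDisjoint (ι u) (ι v) (lift (proj₁ π)) (lift (proj₁ ρ))
  lift-disjoint (w , _) (w′ , _) _ dj z z∈ z∈′ with kind z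
  ... | vertex a = [ inj₁ ∘ cong ι , inj₂ ∘ cong ι ]′ (dj a (ι-∈-lift w z∈) (ι-∈-lift w′ z∈′))
  lift-disjoint {u} {v} {p} {q} π@(w , _) ρ@(w′ , _) p≢q dj z z∈ z∈′ | edge k
    with ε-∈-lift w z∈ | ε-∈-lift w′ z∈′
  ... | x , y , xy , x-k , y-k | x′ , y′ , xy′ , x′-k , y′-k = ⊥-elim (p≢q (trans p-direct (≡-sym q-direct)))
    where
    p-direct : p ≡ u ∷ v ∷ []
    p-direct = InG.consecutive-ends⇒direct π xy (InG.adj⇒≢ (InG.consecutive-adjacent w xy))
      (dj x (proj₁ (consecutive-∈ xy)) (endpoint-∈ w′ xy′ x′-k y′-k x-k))
      (dj y (proj₂ (consecutive-∈ xy)) (endpoint-∈ w′ xy′ x′-k y′-k y-k))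
    q-direct : q ≡ u ∷ v ∷ []
    q-direct = InG.consecutive-ends⇒direct ρ xy′ (InG.adj⇒≢ (InG.consecutive-adjacent w′ xy′))
      (dj x′ (endpoint-∈ w xy x-k y-k x′-k) (proj₁ (consecutive-∈ xy′)))
      (dj y′ (endpoint-∈ w xy x-k y-k y′-k) (proj₂ (consecutive-∈ xy′)))

  lift-transfer : ∀ {u v} → PathTransfer G SG u v (ι u) (ι v)
  lift-transfer = record
    { image = λ π → lift (proj₁ π)
    ; image-path = λ (w , p!) → lift-walk w , lift-unique w p!
    ; image-distinct = λ (w , _) (w′ , _) p≢q _ eq →
        p≢q (trans (≡-sym (vertices-lift w)) (trans (cong vertices eq) (vertices-lift w′)))
    ; image-disjoint = lift-disjoint
    }

  project : ∀ {u z p} → Walk SG (ι u) z p → Unique p →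
            ∃[ a ] (Walk G u a (vertices p) × (z ≡ ι a ⊎ ∃[ k ] (z ≡ ε k × Incident a k)))
  project {u} (here _) _ = u , subst (Walk G u u) (≡-sym (vertices-ι u [])) (here u) , inj₁ refl
  project {u} (step t rest) p! with neighbour-of-vertex t
  ... | k , refl , u-k with rest
  ...   | here _ = u , subst (Walk G u u) (≡-sym (vertices-ιε u k [])) (here u) , inj₂ (k , refl , u-k)
  ...   | step t′ rest′ with neighbour-of-edge t′
  ...     | c , refl , c-k with p!
  ...       | u∉ ∷ _ ∷ rest′! with project rest′ rest′!
  ...         | a , w , end =
    a , subst (Walk G u a) (≡-sym (vertices-ιε u k _)) (step (incident-adjacent u≢c u-k c-k) w) , end
    where
    u≢c : u ≢ c
    u≢c refl = All¬⇒¬Any u∉ (there (InS.head∈ rest′))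

  project-path : ∀ {u v p} → IsPath SG (ι u) (ι v) p → IsPath G u v (vertices p)
  project-path (w , p!) with project w p!
  ... | _ , wa , inj₁ eq = subst (λ b → Walk G _ b _) (≡-sym (ι-injective eq)) wa , vertices-unique p!
  ... | _ , _ , inj₂ (_ , eq , _) = ⊥-elim (ι≢ε eq)

  path-start : ∀ {u v p} → IsPath SG (ι u) (ι v) p → u ≢ v →
               ∃[ k ] ∃[ c ] ∃[ r ] (p ≡ ι u ∷ ε k ∷ ι c ∷ r × Incident u k × Incident c k × u ≢ c)
  path-start (w , p!) u≢v with InS.first-step w (u≢v ∘ ι-injective)
  ... | _ , _ , refl , t , rest with neighbour-of-vertex t
  ...   | k , refl , u-k with InS.first-step rest (ι≢ε ∘ ≡-sym)
  ...     | _ , _ , refl , t′ , rest′ with neighbour-of-edge t′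
  ...       | c , refl , c-k with InS.walk-head rest′
  ...         | r , refl = k , c , r , refl , u-k , c-k , u≢c
    where
    u≢c : _ ≢ c
    u≢c refl = Unique[x∷xs]⇒x∉xs p! (there (here refl))

  -- Equal projections would leave u along the same edge, which the two paths cannot share.
  project-distinct : ∀ {u v p q} → IsPath SG (ι u) (ι v) p → IsPath SG (ι u) (ι v) q → u ≢ v →
                     InternallyDisjoint (ι u) (ι v) p q → vertices p ≢ vertices q
  project-distinct {u} π ρ u≢v dj eq with path-start π u≢v | path-start ρ u≢v
  ... | k , c , r , refl , u-k , c-k , u≢c | k′ , c′ , r′ , refl , u-k′ , c′-k′ , _
    with cong (second u) (trans (≡-sym (vertices-ιει u k c r)) (trans eq (vertices-ιει u k′ c′ r′)))
  ... | refl with edge-unique u≢c u-k c-k u-k′ c′-k′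
  ...   | refl = [ ι≢ε ∘ ≡-sym , ι≢ε ∘ ≡-sym ]′ (dj (ε k) (there (here refl)) (there (here refl)))

  project-transfer : ∀ {u v} → u ≢ v → PathTransfer SG G (ι u) (ι v) u v
  project-transfer u≢v = record
    { image = λ {p} _ → vertices p
    ; image-path = project-path
    ; image-distinct = λ π ρ _ → project-distinct π ρ u≢v
    ; image-disjoint = λ {p} {q} _ _ _ dj z z∈p z∈q →
        [ inj₁ ∘ ι-injective , inj₂ ∘ ι-injective ]′ (dj (ι z) (∈-vertices⁻ p z∈p) (∈-vertices⁻ q z∈q))
    }

  κ-vertices : ∀ {a b k k′} → a ≢ b → IsKappa SG (ι a) (ι b) k → IsKappa G a b k′ → k ≡ k′
  κ-vertices a≢b κS κG =
    ≤-antisym (PathTransfer.κ-mono (project-transfer a≢b) κS κG) (PathTransfer.κ-mono lift-transfer κG κS)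

  κ-from-edge≤2 : ∀ {k y κ} → ε k ≢ y → IsKappa SG (ε k) y κ → κ ≤ 2
  κ-from-edge≤2 {k} ε≢y = κ≤2-at-degree-2 ε≢y (edge-neighbours k)

  κ-to-edge≤2 : ∀ {x k κ} → x ≢ ε k → IsKappa SG x (ε k) κ → κ ≤ 2
  κ-to-edge≤2 x≢ε = κ-from-edge≤2 (x≢ε ∘ ≡-sym) ∘ IsKappa-sym

  module _ (2-connected : TwoConnected G) where
    private
      avoidG : InG.Avoidance
      avoidG = proj₂ (proj₂ 2-connected)

    lift-avoiding-vertex : ∀ {c a b} → a ≢ c → b ≢ c → InS.WalkAvoiding (ι c) (ι a) (ι b)
    lift-avoiding-vertex a≢c b≢c =
      let (_ , w , c∉) = avoidG _ _ _ a≢c b≢c in lift w , lift-walk w , c∉ ∘ ι-∈-lift w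

    lift-avoiding-edge : ∀ {c k a b} → Incident c k → a ≢ c → b ≢ c → InS.WalkAvoiding (ε k) (ι a) (ι b)
    lift-avoiding-edge c-k a≢c b≢c =
      let (_ , w , c∉) = avoidG _ _ _ a≢c b≢c in lift w , lift-walk w , ε∉lift w c-k c∉

    step-from-edge : ∀ {x h k a} → Incident a k → ε k ≢ x →
                     InS.WalkAvoiding x (ι a) h → InS.WalkAvoiding x (ε k) h
    step-from-edge a-k = InS.avoiding-step (InS.adj-sym (incident⇒adj a-k))

    Hub : Fin (N + M) → Fin (N + M) → Set
    Hub x h = ∀ y → y ≢ x → InS.WalkAvoiding x y h

    vertex-hub : ∀ c → ∃[ d ] Hub (ι c) (ι d)
    vertex-hub c with third (proj₁ 2-connected) c c
    ... | d , d≢c , _ = d , reach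
      where
      reach : Hub (ι c) (ι d)
      reach y y≢ιc with kind y
      ... | vertex a = lift-avoiding-vertex (y≢ιc ∘ cong ι) d≢c
      ... | edge k with endpoint-avoiding k c
      ...   | a , a-k , a≢c = step-from-edge a-k y≢ιc (lift-avoiding-vertex a≢c d≢c)

    to-first-end : ∀ e a → InS.WalkAvoiding (ε e) (ι a) (ι (proj₁ (ends e)))
    to-first-end e a with a ≟ proj₁ (ends e) | a ≟ proj₂ (ends e)
    ... | yes refl | _ = _ , here _ , λ { (here eq) → ι≢ε (≡-sym eq) }
    ... | no _ | no a≢eb = lift-avoiding-edge (inj₂ refl) a≢eb (ends-distinct e)
    ... | no _ | yes refl with third (proj₁ 2-connected) (proj₁ (ends e)) (proj₂ (ends e))
    ...   | c , c≢ea , c≢eb = InS.avoiding-++ (lift-avoiding-edge (inj₁ refl) (ends-distinct e ∘ ≡-sym) c≢ea)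
                                             (lift-avoiding-edge (inj₂ refl) c≢eb (ends-distinct e))

    edge-hub : ∀ e → Hub (ε e) (ι (proj₁ (ends e)))
    edge-hub e y y≢εe with kind y
    ... | vertex a = to-first-end e a
    ... | edge k = step-from-edge (inj₁ refl) y≢εe (to-first-end e _)

    hub : ∀ x → ∃[ h ] Hub x h
    hub x with kind x
    ... | vertex c = _ , proj₂ (vertex-hub c)
    ... | edge e = _ , edge-hub e

    subdivision-avoidance : InS.Avoidance
    subdivision-avoidance x u w u≢x w≢x =
      InS.avoiding-++ (proj₂ (hub x) u u≢x) (InS.avoiding-reverse (proj₂ (hub x) w w≢x))

    subdivision-2-connected : TwoConnected SG
    subdivision-2-connected =
      3≤N+M , InS.avoidance⇒connected 3≤N+M subdivision-avoidance , subdivision-avoidance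
      where
      3≤N+M : 3 ≤ N + M
      3≤N+M = ≤-trans (proj₁ 2-connected) (m≤m+n N M)

  module _ (e₀ : Fin M) (two-paths : ∀ a → TwoPaths SG (ι a) (ε e₀)) where
    private
      ea eb : Fin N
      ea = proj₁ (ends e₀)
      eb = proj₂ (ends e₀)

    project-to-edge : ∀ {u x p} → IsPath SG (ι u) (ε e₀) p → ι x ∉ p →
                      ∃[ a ] (Incident a e₀ × InG.WalkAvoiding x u a)
    project-to-edge (w , p!) x∉p with project w p!
    ... | _ , _ , inj₁ eq = ⊥-elim (ι≢ε (≡-sym eq))
    ... | a , wa , inj₂ (_ , eq , a-e₀) with ε-injective eq
    ...   | refl = a , a-e₀ , _ , wa , x∉p ∘ ∈-vertices⁻ _

    reach-edge : ∀ u x → u ≢ x → ∃[ a ] (Incident a e₀ × InG.WalkAvoiding x u a)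
    reach-edge u x u≢x =
      let (_ , π , x∉p) = TwoPaths-avoiding (two-paths u) (ι x) (u≢x ∘ ≡-sym ∘ ι-injective) ι≢ε
      in project-to-edge π x∉p

    avoidance : InG.Avoidance
    avoidance x u w u≢x w≢x with reach-edge u x u≢x | reach-edge w x w≢x
    ... | a , a-e₀ , to-a@(_ , walk-a , x∉) | b , b-e₀ , to-b with a ≟ b
    ...   | yes refl = InG.avoiding-++ to-a (InG.avoiding-reverse to-b)
    ...   | no a≢b =
      InG.avoiding-++ to-a (InG.avoiding-step (incident-adjacent a≢b a-e₀ b-e₀) a≢x (InG.avoiding-reverse to-b))
      where
      a≢x : a ≢ x
      a≢x refl = x∉ (InG.last∈ walk-a)

    -- Leaving ea along an edge f ≠ e₀ reaches the other end of f, a vertex distinct from ea and eb.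
    leaves-edge : ∀ {p} → IsPath SG (ι ea) (ε e₀) p → p ≢ ι ea ∷ ε e₀ ∷ [] → 3 ≤ N
    leaves-edge π@(w , _) p≢direct with neighbour-of-vertex (InS.second-adjacent w ι≢ε)
    ... | f , second≡εf , ea-f with f ≟ e₀
    ...   | yes refl = ⊥-elim (p≢direct (InS.second≡end⇒direct π ι≢ε second≡εf))
    ...   | no f≢e₀ with other-end ea-f
    ...     | c , c-f , ea≢c = three-distinct⇒3≤ (ends-distinct e₀) ea≢c eb≢c
      where
      eb≢c : eb ≢ c
      eb≢c refl = f≢e₀ (edge-unique (ends-distinct e₀) ea-f c-f (inj₁ refl) (inj₂ refl))

    at-least-three : 3 ≤ N
    at-least-three = via (≡-dec _≟_ p (ι ea ∷ ε e₀ ∷ []))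
      where
      open TwoPaths (two-paths ea)
      via : Dec (p ≡ ι ea ∷ ε e₀ ∷ []) → 3 ≤ N
      via (no p≢direct) = leaves-edge p-path p≢direct
      via (yes p≡direct) = leaves-edge q-path (λ q≡direct → distinct (trans p≡direct (≡-sym q≡direct)))

    2-connected-of-paths : TwoConnected G
    2-connected-of-paths = at-least-three , InG.avoidance⇒connected at-least-three avoidance , avoidance

module Bound (G : Graph) where
  open Subdivision G
  open PairSums
  open import Data.Fin using (toℕ; fromℕ<)
  open import Data.Fin.Properties using (splitAt-↑ˡ; splitAt-↑ʳ; toℕ-↑ˡ; toℕ-↑ʳ; toℕ<n)
  open import Data.Nat.Properties using (≤-trans; m≤m+n; ≤-reflexive; ≤-antisym; m+n∸m≡n)

  bound-ιι : ∀ κ a b → κ-bound N M κ (ι a) (ι b) ≡ κ a b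
  bound-ιι κ a b rewrite splitAt-↑ˡ N a M | splitAt-↑ˡ N b M = refl

  bound-ιε : ∀ κ a k → κ-bound N M κ (ι a) (ε k) ≡ 2
  bound-ιε κ a k rewrite splitAt-↑ˡ N a M | splitAt-↑ʳ N M k = refl

  bound-ε : ∀ κ k y → κ-bound N M κ (ε k) y ≡ 2
  bound-ε κ k y rewrite splitAt-↑ʳ N M k = refl

  vertex-edge-pair : ∀ a k → (ι a , ε k) ∈ pairs (N + M)
  vertex-edge-pair a k =
    <⇒∈-pairs (subst₂ _<_ (≡-sym (toℕ-↑ˡ a M)) (≡-sym (toℕ-↑ʳ N k))
                          (≤-trans (toℕ<n a) (m≤m+n N (toℕ k))))

  total-bound : ∀ κ → pairSum (N + M) (κ-bound N M κ) ≡ 2 * ((N + M) C 2 ∸ N C 2) + pairSum N κ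
  total-bound κ = trans (pairSum-κ-bound N M κ) (cong (λ z → 2 * z + pairSum N κ) (≡-sym new-pairs))
    where
    new-pairs : (N + M) C 2 ∸ N C 2 ≡ N * M + M C 2
    new-pairs = trans (cong (_∸ N C 2) (C2-+ N M)) (m+n∸m≡n (N C 2) _)

  module Connectivities (κS : Fin (N + M) → Fin (N + M) → ℕ) (isS : IsConnectivity SG κS)
           (κG : Fin N → Fin N → ℕ) (isG : IsConnectivity G κG) where

    κ-vertex-pair : ∀ a b → ι a ≢ ι b → κS (ι a) (ι b) ≡ κ-bound N M κG (ι a) (ι b)
    κ-vertex-pair a b ιa≢ιb =
      trans (κ-vertices a≢b (isS _ _ ιa≢ιb) (isG a b a≢b)) (≡-sym (bound-ιι κG a b))
      where
      a≢b : a ≢ b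
      a≢b = ιa≢ιb ∘ cong ι

    κS≤bound : ∀ x y → x ≢ y → κS x y ≤ κ-bound N M κG x y
    κS≤bound x y x≢y with kind x | kind y
    ... | vertex a | vertex b = ≤-reflexive (κ-vertex-pair a b x≢y)
    ... | vertex a | edge k = subst (κS _ _ ≤_) (≡-sym (bound-ιε κG a k)) (κ-to-edge≤2 x≢y (isS _ _ x≢y))
    ... | edge k | _ = subst (κS _ _ ≤_) (≡-sym (bound-ε κG k y)) (κ-from-edge≤2 x≢y (isS _ _ x≢y))

    2≤κS : TwoConnected G → ∀ {x y} → x ≢ y → 2 ≤ κS x y
    2≤κS 2-connected x≢y =
      TwoPaths⇒2≤κ (Whitney.two-paths SG (subdivision-2-connected 2-connected) x≢y) (isS _ _ x≢y)

    bound≤κS : TwoConnected G → ∀ x y → x ≢ y → κ-bound N M κG x y ≤ κS x y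
    bound≤κS 2-connected x y x≢y with kind x | kind y
    ... | vertex a | vertex b = ≤-reflexive (≡-sym (κ-vertex-pair a b x≢y))
    ... | vertex a | edge k = subst (_≤ κS _ _) (≡-sym (bound-ιε κG a k)) (2≤κS 2-connected x≢y)
    ... | edge k | _ = subst (_≤ κS _ _) (≡-sym (bound-ε κG k y)) (2≤κS 2-connected x≢y)

    below-bound : TotalConn SG κS ≤ pairSum (N + M) (κ-bound N M κG)
    below-bound = pairSum-mono (N + M) κS≤bound

    2-connected⇒tight : TwoConnected G → TotalConn SG κS ≡ pairSum (N + M) (κ-bound N M κG)
    2-connected⇒tight 2-connected =
      pairSum-cong (N + M) (λ x y x≢y → ≤-antisym (κS≤bound x y x≢y) (bound≤κS 2-connected x y x≢y))

    tight⇒2-connected : 1 ≤ M → TotalConn SG κS ≡ pairSum (N + M) (κ-bound N M κG) → TwoConnected G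
    tight⇒2-connected 1≤M tight = 2-connected-of-paths e₀ two-paths
      where
      e₀ : Fin M
      e₀ = fromℕ< 1≤M
      κ≡2 : ∀ a → κS (ι a) (ε e₀) ≡ 2
      κ≡2 a = trans (pairSum-≡⇒≡ (N + M) κS≤bound tight (vertex-edge-pair a e₀)) (bound-ιε κG a e₀)
      two-paths : ∀ a → TwoPaths SG (ι a) (ε e₀)
      two-paths a = κ≡2⇒TwoPaths (subst (IsKappa SG (ι a) (ε e₀)) (κ≡2 a) (isS _ _ ι≢ε))

lemma4p8 : (G : Graph) →
    (κS : Fin (n (S G)) → Fin (n (S G)) → ℕ) → IsConnectivity (S G) κS →
    (κG : Fin (n G) → Fin (n G) → ℕ) → IsConnectivity G κG →
    (TotalConn (S G) κS ≤ 2 * (((n G + size G) C 2) ∸ (n G C 2)) + TotalConn G κG)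
    × (1 ≤ size G →
        ((TotalConn (S G) κS ≡ 2 * (((n G + size G) C 2) ∸ (n G C 2)) + TotalConn G κG → TwoConnected G)
         × (TwoConnected G → TotalConn (S G) κS ≡ 2 * (((n G + size G) C 2) ∸ (n G C 2)) + TotalConn G κG)))
lemma4p8 G κS isS κG isG =
  subst (TotalConn (S G) κS ≤_) (total-bound κG) below-bound ,
  λ 1≤m → (λ tight → tight⇒2-connected 1≤m (trans tight (≡-sym (total-bound κG)))) ,
          (λ 2-connected → trans (2-connected⇒tight 2-connected) (total-bound κG))
  where
  open Bound G
  open Connectivities κS isS κG isG
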